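{- Let $\mathrm{M}$ be a matroid. If $G$ is a proper flat, then the kernel of $\varphi_G \colon A^{\bullet}(\mathrm{M}) \to A^{\bullet}(\mathrm{M}^G) \otimes \underline{A}^{\bullet}(\mathrm{M}_G)$ is contained in the annihilator of $x_G \in A^{\bullet}(\mathrm{M})$. Similarly, if $G$ is a proper nonempty flat, then the kernel of $\varphi_G \colon \underline{A}^{\bullet}(\mathrm{M}) \to \underline{A}^{\bullet}(\mathrm{M}^G) \otimes \underline{A}^{\bullet}(\mathrm{M}_G)$ is contained in the annihilator of $x_G \in \underline{A}^{\bullet}(\mathrm{M})$.
   Context: A matroid $\mathrm{M}$ is a finite nonempty atomic ranked lattice $\mathcal{L}_{\mathrm{M}}$ (every element is the join of the atoms below it; every maximal chain in $[\emptyset, F]$ has length $\operatorname{rk}(F)$) whose rank function $\operatorname{rk}$ is submodular. Elements are flats; minimal element $\emptyset$, maximal $E$; a flat is proper if it is not $E$ and nonempty if it is not $\emptyset$. Let $\overline{\mathcal{L}}_{\mathrm{M}} = \mathcal{L}_{\mathrm{M}} \setminus \{\emptyset\}$. The augmented Chow ring $A^{\bullet}(\mathrm{M})$ is the quotient of $\mathbb{Z}[h_F]_{F \in \overline{\mathcal{L}}_{\mathrm{M}}}$ by $((h_{F} - h_{G \vee F})(h_G - h_{G \vee F}) : F, G) + (h_a^2,\ h_ah_F - h_ah_{F \vee a} : F \in \overline{\mathcal{L}}_{\mathrm{M}},\ a \text{ atom})$; the Chow ring $\underline{A}^{\bullet}(\mathrm{M})$ is the quotient of $\mathbb{Z}[h_F]_{F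 \in \overline{\mathcal{L}}_{\mathrm{M}}}$ by $((h_{F} - h_{G \vee F})(h_G - h_{G \vee F}) : F, G) + (h_a : a \text{ atom})$. For a flat $G$, $\mathrm{M}^G$ has lattice of flats $[\emptyset, G]$ and $\mathrm{M}_G$ has lattice of flats $[G, E]$ (with minimal element $G$); $A^{\bullet}(\mathrm{M}^\emptyset) := \mathbb{Z}$. For $G$ proper, $\varphi_G \colon A^{\bullet}(\mathrm{M}) \to A^{\bullet}(\mathrm{M}^G) \otimes \underline{A}^{\bullet}(\mathrm{M}_G)$ is the ring homomorphism with $\varphi_G(h_F) = h_F \otimes 1$ if $F \le G$ and $\varphi_G(h_F) = 1 \otimes h_{F \vee G}$ otherwise; for $G$ proper nonempty, $\varphi_G \colon \underline{A}^{\bullet}(\mathrm{M}) \to \underline{A}^{\bullet}(\mathrm{M}^G) \otimes \underline{A}^{\bullet}(\mathrm{M}_G)$ is defined by the same formulas. For a proper flat $G$, let $\mathcal{A}$ be the set of atoms not contained in $G$, set $h_\emptyset = 0$, and define $x_G = -\sum_{S \subseteq \mathcal{A}} (-1)^{|S|} h_{G \vee \bigvee_{a \in S} a}$ (in $A^{\bullet}(\mathrm{M})$, or in $\underline{A}^{\bullet}(\mathrm{M})$ when $G$ is also nonempty). -}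

module Defs where

open import Data.Nat using (ℕ; zero; suc) renaming (_+_ to _+ℕ_; _≤_ to _≤ℕ_)
open import Data.Fin using (Fin) renaming (_≟_ to _≟F_)
open import Data.Fin.Properties using (all?)
open import Data.List using (List; []; _∷_; filter; foldr; length; map)
open import Data.List.Base using (allFin)
open import Data.Product using (Σ; _×_; _,_)
open import Data.Sum using (_⊎_; inj₁; inj₂)
open import Relation.Nullary using (¬_; Dec; yes; no)
open import Relation.Nullary.Decidable using (_×-dec_; _⊎-dec_; _→-dec_; ¬?)
open import Relation.Binary.PropositionalEquality using (_≡_; _≢_)
open import Relation.Binary.Definitions using (Decidable)
open import Relation.Binary.Lattice.Structures using (IsBoundedLattice)

record FinLattice : Set₁ where
  field
    n    : ℕ
    _≤_  : Fin n → Fin n → Set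
    _≤?_ : Decidable _≤_
    _∨_  : Fin n → Fin n → Fin n
    _∧_  : Fin n → Fin n → Fin n
    ⊤    : Fin n
    ⊥    : Fin n
    isBoundedLattice : IsBoundedLattice _≡_ _≤_ _∨_ _∧_ ⊤ ⊥

  infixr 6 _∨_
  infix 4 _≤_

  Covers : Fin n → Fin n → Set
  Covers x y = (x ≤ y) × (x ≢ y) × (∀ z → x ≤ z → z ≤ y → (z ≡ x) ⊎ (z ≡ y))

  covers? : ∀ x y → Dec (Covers x y)
  covers? x y = (x ≤? y) ×-dec (¬? (x ≟F y)) ×-dec
    all? (λ z → (x ≤? z) →-dec ((z ≤? y) →-dec ((z ≟F x) ⊎-dec (z ≟F y))))

  IsAtom : Fin n → Set
  IsAtom a = Covers ⊥ a

  -- saturated chains x = x₀ ⋖ x₁ ⋖ … ⋖ x_k = y, indexed by their length k;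
  -- these are exactly the maximal chains of the interval [x, y]
  data SatChain (x : Fin n) : Fin n → ℕ → Set where
    done : SatChain x x zero
    step : ∀ {y z k} → SatChain x y k → Covers y z → SatChain x z (suc k)

  atomsNotBelow : Fin n → List (Fin n)
  atomsNotBelow G = filter (λ a → covers? ⊥ a ×-dec ¬? (a ≤? G)) (allFin n)

-- Matroids: finite nonempty atomic ranked lattices with submodular rank.

record Matroid : Set₁ where
  field
    lattice : FinLattice
  open FinLattice lattice public
  field
    rk : Fin n → ℕ
    -- atomic: every flat is the join of the atoms below it, i.e. F is the
    -- least upper bound of {a atom : a ≤ F} (F is trivially an upper bound)
    atomic : ∀ F → ∀ U → (∀ a → IsAtom a → a ≤ F → a ≤ U) → F ≤ U
    ranked : ∀ F k → SatChain ⊥ F k → k ≡ rk F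
    submodular : ∀ F G → rk (F ∨ G) +ℕ rk (F ∧ G) ≤ℕ rk F +ℕ rk G

data Tm (V : Set) : Set where
  var : V → Tm V
  0# 1# : Tm V
  _+_ _*_ : Tm V → Tm V → Tm V
  -_ : Tm V → Tm V

infixl 6 _+_ _-_
infixl 7 _*_
infix 8 -_

_-_ : ∀ {V} → Tm V → Tm V → Tm V
p - q = p + (- q)

bind : ∀ {V W : Set} → (V → Tm W) → Tm V → Tm W
bind σ (var v) = σ v
bind σ 0# = 0#
bind σ 1# = 1#
bind σ (p + q) = bind σ p + bind σ q
bind σ (p * q) = bind σ p * bind σ q
bind σ (- p) = - bind σ p

rename : ∀ {V W : Set} → (V → W) → Tm V → Tm W
rename f = bind (λ v → var (f v))

-- Equality in the quotient ring ℤ[V] / (R), where R is a predicate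
-- singling out the ideal generators: the congruence generated by the
-- commutative ring axioms and  r ≈ 0  for every generator r.
data Eq {V : Set} (R : Tm V → Set) : Tm V → Tm V → Set where
  refl' : ∀ {p} → Eq R p p
  sym'  : ∀ {p q} → Eq R p q → Eq R q p
  trans' : ∀ {p q r} → Eq R p q → Eq R q r → Eq R p r
  +-cong : ∀ {p p' q q'} → Eq R p p' → Eq R q q' → Eq R (p + q) (p' + q')
  *-cong : ∀ {p p' q q'} → Eq R p p' → Eq R q q' → Eq R (p * q) (p' * q')
  neg-cong : ∀ {p p'} → Eq R p p' → Eq R (- p) (- p')
  +-assoc : ∀ p q r → Eq R ((p + q) + r) (p + (q + r))
  +-comm : ∀ p q → Eq R (p + q) (q + p)
  +-idʳ : ∀ p → Eq R (p + 0#) p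
  +-invʳ : ∀ p → Eq R (p + (- p)) 0#
  *-assoc : ∀ p q r → Eq R ((p * q) * r) (p * (q * r))
  *-comm : ∀ p q → Eq R (p * q) (q * p)
  *-idʳ : ∀ p → Eq R (p * 1#) p
  distribʳ : ∀ p q r → Eq R ((q + r) * p) ((q * p) + (r * p))
  gen : ∀ {r} → R r → Eq R r 0#

-- Presentation of the tensor product of two presented ℤ-algebras:
-- disjoint union of generators, union of relations.
TensorRel : ∀ {V W : Set} → (Tm V → Set) → (Tm W → Set) → Tm (V ⊎ W) → Set
TensorRel {V} {W} R S p =
  (Σ (Tm V) λ q → R q × (p ≡ rename inj₁ q)) ⊎ (Σ (Tm W) λ q → S q × (p ≡ rename inj₂ q))

-- Variables are indexed by all of Fin n, h_F := var F; the variables not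
-- in the half-open interval (lo, hi] are set to zero (in particular
-- h_lo = 0, the convention for the minimal flat), so the ring is
-- ℤ[h_F : lo < F ≤ hi] modulo the stated relations.

module _ (M : Matroid) where
  open Matroid M

  InOpen : Fin n → Fin n → Fin n → Set
  InOpen lo hi F = (lo ≤ F) × (lo ≢ F) × (F ≤ hi)

  h : Fin n → Tm (Fin n)
  h = var

  data AugRel (lo hi : Fin n) : Tm (Fin n) → Set where
    outside : ∀ F → ¬ InOpen lo hi F → AugRel lo hi (h F)
    quad : ∀ F G → InOpen lo hi F → InOpen lo hi G →
           AugRel lo hi ((h F - h (G ∨ F)) * (h G - h (G ∨ F)))
    atomSq : ∀ a → Covers lo a → a ≤ hi → AugRel lo hi (h a * h a)
    atomMul : ∀ a F → Covers lo a → a ≤ hi → InOpen lo hi F →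
              AugRel lo hi (h a * h F - h a * h (F ∨ a))

  data ChowRel (lo hi : Fin n) : Tm (Fin n) → Set where
    outside : ∀ F → ¬ InOpen lo hi F → ChowRel lo hi (h F)
    quad : ∀ F G → InOpen lo hi F → InOpen lo hi G →
           ChowRel lo hi ((h F - h (G ∨ F)) * (h G - h (G ∨ F)))
    atom : ∀ a → Covers lo a → a ≤ hi → ChowRel lo hi (h a)

  augRel : Tm (Fin n) → Set
  augRel = AugRel ⊥ ⊤

  chowRel : Tm (Fin n) → Set
  chowRel = ChowRel ⊥ ⊤

  φ : Fin n → Tm (Fin n) → Tm (Fin n ⊎ Fin n)
  φ G = bind σ
    where
    σ : Fin n → Tm (Fin n ⊎ Fin n)
    σ F with F ≤? G
    ... | yes _ = var (inj₁ F)
    ... | no  _ = var (inj₂ (F ∨ G))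

  subsets : List (Fin n) → List (List (Fin n))
  subsets [] = [] ∷ []
  subsets (a ∷ as) = subsets as Data.List.++ map (a ∷_) (subsets as)

  sign : ℕ → Tm (Fin n)
  sign zero = 1#
  sign (suc k) = - sign k

  sumTm : List (Tm (Fin n)) → Tm (Fin n)
  sumTm = foldr _+_ 0#

  x : Fin n → Tm (Fin n)
  x G = - sumTm (map (λ S → sign (length S) * h (foldr _∨_ G S)) (subsets (atomsNotBelow G)))

-- Lifting h_F ⊗ 1 (F ≤ G) and 1 ⊗ h_F (F > G) back to h_F gives a map θ from the tensor
-- product to A(M) which, modulo the annihilator of x_G, is a ring homomorphism with
-- θ ∘ φ_G = id; so φ_G(p) = 0 forces x_G p = x_G θ(φ_G(p)) = 0.  Here θ ∘ φ_G = id amounts to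
-- x_G h_F = x_G h_{F ∨ G} for F ≰ G, and θ respecting the relations of the tensor product
-- amounts (besides relations of A(M) itself) to x_G h_a = 0 for a covering G, which follows
-- from the former with a = b ∨ G for an atom b, once x_G h_b = 0 for atoms b ≰ G.
-- Both identities come from one cancellation.  Expand x_G as the alternating sum of
-- h_{G ∨ ⋁S} over sets S of atoms not below G.  If h_K c depends only on K ∨ F for some
-- F ≰ G, then for an atom b ≤ F with b ≰ G the terms of S and S ∪ {b} in x_G c cancel.
-- The quadratic relations give this for c = h_F − h_{F ∨ G}, and the atom relations of the
-- augmented ring (h_K h_b = h_{K ∨ b} h_b) give it for c = h_b.

module Submission where

open import Defs
open import Level using (0ℓ)
open import Algebra.Bundles using (CommutativeRing)
open import Algebra.Structures using (IsCommutativeRing)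
open import Data.Fin using (Fin) renaming (_≟_ to _≟F_)
open import Data.Fin.Properties using (any?)
open import Data.List using (List; []; _∷_; foldr; length; map; _++_)
open import Data.List.Properties using (map-++)
open import Data.List.Relation.Unary.Any using (here; there)
open import Data.List.Membership.Propositional using (_∈_)
open import Data.List.Membership.Propositional.Properties using (∈-filter⁺; ∈-allFin)
open import Data.Product using (_×_; _,_; ∃)
open import Data.Sum using (inj₁; inj₂; [_,_])
open import Function using (_∘_)
open import Relation.Nullary using (¬_; Dec; yes; no)
open import Relation.Nullary.Decidable using (_×-dec_; ¬?; decidable-stable)
open import Relation.Nullary.Negation using (contradiction)
open import Relation.Binary.Core using (Rel)
open import Relation.Binary.PropositionalEquality
  using (_≡_; _≢_; refl; sym; trans; cong; cong₂; subst; module ≡-Reasoning)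
open import Relation.Binary.Lattice.Bundles using (BoundedJoinSemilattice)
open import Relation.Binary.Lattice.Structures using (IsBoundedLattice)

Eq-isCommutativeRing : ∀ {V : Set} (R : Tm V → Set) → IsCommutativeRing (Eq R) _+_ _*_ -_ 0# 1#
Eq-isCommutativeRing R = record
  { isRing = record
    { +-isAbelianGroup = record
      { isGroup = record
        { isMonoid = record
          { isSemigroup = record
            { isMagma = record
              { isEquivalence = record { refl = refl' ; sym = sym' ; trans = trans' }
              ; ∙-cong = +-cong }
            ; assoc = +-assoc }
          ; identity = (λ p → trans' (+-comm 0# p) (+-idʳ p)) , +-idʳ }
        ; inverse = (λ p → trans' (+-comm (- p) p) (+-invʳ p)) , +-invʳ
        ; ⁻¹-cong = neg-cong }
      ; comm = +-comm }
    ; *-cong = *-cong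
    ; *-assoc = *-assoc
    ; *-identity = (λ p → trans' (*-comm 1# p) (*-idʳ p)) , *-idʳ
    ; distrib = (λ p q r → trans' (*-comm p (q + r))
                             (trans' (distribʳ p q r) (+-cong (*-comm q p) (*-comm r p))))
              , distribʳ }
  ; *-comm = *-comm }

quotientRing : ∀ {V : Set} (R : Tm V → Set) → CommutativeRing 0ℓ 0ℓ
quotientRing R = record { isCommutativeRing = Eq-isCommutativeRing R }

module _ {V : Set} {R : Tm V → Set} where
  private
    module Q = CommutativeRing (quotientRing R)
  open import Algebra.Properties.Ring Q.ring using ([y-z]x≈yx-zx; x∙y⁻¹≈ε⇒x≈y; ⁻¹-anti-homo‿-)
  open import Relation.Binary.Reasoning.Setoid Q.setoid

  ≈0⇒*≈0 : ∀ x {y} → Eq R y 0# → Eq R (x * y) 0#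
  ≈0⇒*≈0 x y≈0 = Q.trans (Q.*-congˡ y≈0) (Q.zeroʳ x)

  [x-y]z≈0⇒xz≈yz : ∀ x y z → Eq R ((x - y) * z) 0# → Eq R (x * z) (y * z)
  [x-y]z≈0⇒xz≈yz x y z [x-y]z≈0 = x∙y⁻¹≈ε⇒x≈y _ _ (Q.trans (Q.sym ([y-z]x≈yx-zx z x y)) [x-y]z≈0)

  x-y≈[x-z]-[y-z] : ∀ x y z → Eq R (x - y) ((x - z) - (y - z))
  x-y≈[x-z]-[y-z] x y z = begin
    x - y                   ≈⟨ Q.+-congʳ (Q.+-identityʳ x) ⟨
    (x + 0#) - y            ≈⟨ Q.+-congʳ (Q.+-congˡ (Q.-‿inverseˡ z)) ⟨
    (x + (- z + z)) - y     ≈⟨ Q.+-congʳ (Q.+-assoc x (- z) z) ⟨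
    ((x - z) + z) - y       ≈⟨ Q.+-assoc (x - z) z (- y) ⟩
    (x - z) + (z - y)       ≈⟨ Q.+-congˡ (⁻¹-anti-homo‿- y z) ⟨
    (x - z) - (y - z)       ∎

bind-rename : ∀ {U V W : Set} (θ : V → Tm W) (f : U → V) (q : Tm U) →
  bind θ (rename f q) ≡ bind (θ ∘ f) q
bind-rename θ f (var u) = refl
bind-rename θ f 0# = refl
bind-rename θ f 1# = refl
bind-rename θ f (p + q) = cong₂ _+_ (bind-rename θ f p) (bind-rename θ f q)
bind-rename θ f (p * q) = cong₂ _*_ (bind-rename θ f p) (bind-rename θ f q)
bind-rename θ f (- p) = cong -_ (bind-rename θ f p)

bind-respects-Eq : ∀ {ℓ} {V W : Set} {R : Tm V → Set} {_≈_ : Rel (Tm W) ℓ} →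
  IsCommutativeRing _≈_ _+_ _*_ -_ 0# 1# → (θ : V → Tm W) → (∀ {r} → R r → bind θ r ≈ 0#) →
  ∀ {p q} → Eq R p q → bind θ p ≈ bind θ q
bind-respects-Eq {R = R} {_≈_} isCR θ θ-kills = go
  where
  module C = IsCommutativeRing isCR
  go : ∀ {p q} → Eq R p q → bind θ p ≈ bind θ q
  go refl' = C.refl
  go (sym' e) = C.sym (go e)
  go (trans' e e') = C.trans (go e) (go e')
  go (+-cong e e') = C.+-cong (go e) (go e')
  go (*-cong e e') = C.*-cong (go e) (go e')
  go (neg-cong e) = C.-‿cong (go e)
  go (+-assoc p q r) = C.+-assoc _ _ _
  go (+-comm p q) = C.+-comm _ _
  go (+-idʳ p) = C.+-identityʳ _
  go (+-invʳ p) = C.-‿inverseʳ _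
  go (*-assoc p q r) = C.*-assoc _ _ _
  go (*-comm p q) = C.*-comm _ _
  go (*-idʳ p) = C.*-identityʳ _
  go (distribʳ p q r) = C.distribʳ _ _ _
  go (gen r) = θ-kills r

module Annihilator {V : Set} (R : Tm V → Set) where
  private
    module Q = CommutativeRing (quotientRing R)
  open import Algebra.Properties.Ring Q.ring using (-‿distribʳ-*)
  open import Algebra.Properties.CommutativeSemigroup Q.*-commutativeSemigroup using (x∙yz≈y∙xz)
  open import Relation.Binary.Reasoning.Setoid Q.setoid

  -- Equality in (ℤ[V]/R) / Ann(X).
  infix 4 _≈[_]_
  _≈[_]_ : Tm V → Tm V → Tm V → Set
  a ≈[ X ] b = Eq R (X * a) (X * b)

  ≈[]-*-cong : ∀ X {a a' b b'} → a ≈[ X ] a' → b ≈[ X ] b' → a * b ≈[ X ] a' * b'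
  ≈[]-*-cong X {a} {a'} {b} {b'} a≈a' b≈b' = begin
    X * (a * b)   ≈⟨ Q.*-assoc X a b ⟨
    (X * a) * b   ≈⟨ Q.*-congʳ a≈a' ⟩
    (X * a') * b  ≈⟨ Q.*-assoc X a' b ⟩
    X * (a' * b)  ≈⟨ x∙yz≈y∙xz X a' b ⟩
    a' * (X * b)  ≈⟨ Q.*-congˡ b≈b' ⟩
    a' * (X * b') ≈⟨ x∙yz≈y∙xz a' X b' ⟩
    X * (a' * b') ∎

  ≈[]-isCommutativeRing : ∀ X → IsCommutativeRing (λ a b → a ≈[ X ] b) _+_ _*_ -_ 0# 1#
  ≈[]-isCommutativeRing X = record
    { isRing = record
      { +-isAbelianGroup = record
        { isGroup = record
          { isMonoid = record
            { isSemigroup = record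
              { isMagma = record
                { isEquivalence = record { refl = Q.refl ; sym = Q.sym ; trans = Q.trans }
                ; ∙-cong = λ a≈a' b≈b' → Q.trans (Q.distribˡ X _ _)
                             (Q.trans (Q.+-cong a≈a' b≈b') (Q.sym (Q.distribˡ X _ _))) }
              ; assoc = λ a b c → Q.*-congˡ (Q.+-assoc a b c) }
            ; identity = (λ a → Q.*-congˡ (Q.+-identityˡ a)) , (λ a → Q.*-congˡ (Q.+-identityʳ a)) }
          ; inverse = (λ a → Q.*-congˡ (Q.-‿inverseˡ a)) , (λ a → Q.*-congˡ (Q.-‿inverseʳ a))
          ; ⁻¹-cong = λ a≈a' → Q.trans (Q.sym (-‿distribʳ-* X _))
                                 (Q.trans (Q.-‿cong a≈a') (-‿distribʳ-* X _)) }
        ; comm = λ a b → Q.*-congˡ (Q.+-comm a b) }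
      ; *-cong = ≈[]-*-cong X
      ; *-assoc = λ a b c → Q.*-congˡ (Q.*-assoc a b c)
      ; *-identity = (λ a → Q.*-congˡ (Q.*-identityˡ a)) , (λ a → Q.*-congˡ (Q.*-identityʳ a))
      ; distrib = (λ a b c → Q.*-congˡ (Q.distribˡ a b c))
                , (λ a b c → Q.*-congˡ (Q.distribʳ a b c)) }
    ; *-comm = λ a b → Q.*-congˡ (Q.*-comm a b) }

module _ {V W : Set} {R : Tm V → Set} {S : Tm W → Set}
         (σ : V → Tm W) (θ : W → Tm V) (X : Tm V) where
  open CommutativeRing (quotientRing R) using (zeroʳ)
  open Annihilator R

  kernel⊆annihilator :
    (∀ v → Eq R (X * var v) (X * bind θ (σ v))) →
    (∀ {r} → S r → Eq R (X * bind θ r) 0#) →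
    ∀ p → Eq S (bind σ p) 0# → Eq R (X * p) 0#
  kernel⊆annihilator X-*-var≈X-*-θσ X-*-θ-rel≈0 p σp≈0 =
    trans' (≈[X]-θσ p)
           (trans' (bind-respects-Eq (≈[]-isCommutativeRing X) θ θ-rel≈[X]0 σp≈0) (zeroʳ X))
    where
    module Q = IsCommutativeRing (≈[]-isCommutativeRing X)
    θ-rel≈[X]0 : ∀ {r} → S r → bind θ r ≈[ X ] 0#
    θ-rel≈[X]0 r = trans' (X-*-θ-rel≈0 r) (sym' (zeroʳ X))
    ≈[X]-θσ : ∀ p → p ≈[ X ] bind θ (bind σ p)
    ≈[X]-θσ (var v) = X-*-var≈X-*-θσ v
    ≈[X]-θσ 0# = Q.refl
    ≈[X]-θσ 1# = Q.refl
    ≈[X]-θσ (p + q) = Q.+-cong (≈[X]-θσ p) (≈[X]-θσ q)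
    ≈[X]-θσ (p * q) = Q.*-cong (≈[X]-θσ p) (≈[X]-θσ q)
    ≈[X]-θσ (- p) = Q.-‿cong (≈[X]-θσ p)

module _ (M : Matroid) where
  open Matroid M
  private
    module L = IsBoundedLattice isBoundedLattice

    joinSemilattice : BoundedJoinSemilattice 0ℓ 0ℓ 0ℓ
    joinSemilattice = record
      { Carrier = Fin n ; _≈_ = _≡_ ; _≤_ = _≤_ ; _∨_ = _∨_ ; ⊥ = ⊥
      ; isBoundedJoinSemilattice = L.isBoundedJoinSemilattice }

  open import Relation.Binary.Lattice.Properties.JoinSemilattice
    (BoundedJoinSemilattice.joinSemilattice joinSemilattice) using (∨-comm; ∨-assoc; x≤y⇒x∨y≈y)
  open import Relation.Binary.Lattice.Properties.BoundedJoinSemilattice joinSemilattice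
    using (identityˡ; identityʳ)

  ∨-lswap : ∀ a b c → a ∨ (b ∨ c) ≡ b ∨ (a ∨ c)
  ∨-lswap a b c = trans (sym (∨-assoc a b c)) (trans (cong (_∨ c) (∨-comm a b)) (∨-assoc b a c))

  ≤⇒[x∨y]∨z≡y∨z : ∀ {x z} y → x ≤ z → (x ∨ y) ∨ z ≡ y ∨ z
  ≤⇒[x∨y]∨z≡y∨z {x} {z} y x≤z = trans (∨-assoc x y z) (x≤y⇒x∨y≈y (L.trans x≤z (L.y≤x∨y y z)))

  ≤⇒x∨[y∨z]≡x∨y : ∀ {x z} y → z ≤ x → x ∨ (y ∨ z) ≡ x ∨ y
  ≤⇒x∨[y∨z]≡x∨y {x} {z} y z≤x = begin
    x ∨ (y ∨ z) ≡⟨ cong (x ∨_) (∨-comm y z) ⟩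
    x ∨ (z ∨ y) ≡⟨ ∨-assoc x z y ⟨
    (x ∨ z) ∨ y ≡⟨ cong (_∨ y) (trans (∨-comm x z) (x≤y⇒x∨y≈y z≤x)) ⟩
    x ∨ y       ∎
    where open ≡-Reasoning

  ≤-foldr-∨ : ∀ x ys → x ≤ foldr _∨_ x ys
  ≤-foldr-∨ x [] = L.refl
  ≤-foldr-∨ x (y ∷ ys) = L.trans (≤-foldr-∨ x ys) (L.y≤x∨y y _)

  ≰⇒∃atom : ∀ {F G} → ¬ F ≤ G → ∃ λ b → IsAtom b × b ≤ F × ¬ b ≤ G
  ≰⇒∃atom {F} {G} F≰G with any? (λ b → covers? ⊥ b ×-dec (b ≤? F) ×-dec ¬? (b ≤? G))
  ... | yes witness = witness
  ... | no ∄witness = contradiction (atomic F G atoms≤G) F≰G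
    where
    atoms≤G : ∀ a → IsAtom a → a ≤ F → a ≤ G
    atoms≤G a a-atom a≤F = decidable-stable (a ≤? G) (λ a≰G → ∄witness (a , a-atom , a≤F , a≰G))

  atom∈atomsNotBelow : ∀ {G b} → IsAtom b → ¬ b ≤ G → b ∈ atomsNotBelow G
  atom∈atomsNotBelow {G} {b} b-atom b≰G =
    ∈-filter⁺ (λ a → covers? ⊥ a ×-dec ¬? (a ≤? G)) (∈-allFin b) (b-atom , b≰G)

  Covers⇒≰ : ∀ {G a} → Covers G a → ¬ a ≤ G
  Covers⇒≰ (G≤a , G≢a , _) a≤G = G≢a (L.antisym G≤a a≤G)

  Covers⇒∨≡ : ∀ {G a F} → Covers G a → F ≤ a → ¬ F ≤ G → F ∨ G ≡ a
  Covers⇒∨≡ {G} {a} {F} (G≤a , _ , between) F≤a F≰G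
    with between (F ∨ G) (L.y≤x∨y F G) (L.∨-least F≤a G≤a)
  ... | inj₁ F∨G≡G = contradiction (subst (F ≤_) F∨G≡G (L.x≤x∨y F G)) F≰G
  ... | inj₂ F∨G≡a = F∨G≡a

  inOpen? : ∀ lo hi F → Dec (InOpen M lo hi F)
  inOpen? lo hi F = (lo ≤? F) ×-dec ¬? (lo ≟F F) ×-dec (F ≤? hi)

  Covers⇒InOpen : ∀ {lo hi a} → Covers lo a → a ≤ hi → InOpen M lo hi a
  Covers⇒InOpen (lo≤a , lo≢a , _) a≤hi = lo≤a , lo≢a , a≤hi

  InOpen-∨ : ∀ {lo hi F K} → InOpen M lo hi F → InOpen M lo hi K → InOpen M lo hi (K ∨ F)
  InOpen-∨ {F = F} {K} (lo≤F , lo≢F , F≤hi) (_ , _ , K≤hi) =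
    L.trans lo≤F (L.y≤x∨y K F) ,
    (λ lo≡K∨F → lo≢F (L.antisym lo≤F (subst (F ≤_) (sym lo≡K∨F) (L.y≤x∨y K F)))) ,
    L.∨-least K≤hi F≤hi

  InOpen⇒InOpen⊥⊤ : ∀ {lo hi F} → InOpen M lo hi F → InOpen M ⊥ ⊤ F
  InOpen⇒InOpen⊥⊤ {lo} {F = F} (lo≤F , lo≢F , _) =
    L.minimum F ,
    (λ ⊥≡F → lo≢F (L.antisym lo≤F (subst (_≤ lo) ⊥≡F (L.minimum lo)))) ,
    L.maximum F

  ≢⊥⇒InOpen⊥⊤ : ∀ {F} → F ≢ ⊥ → InOpen M ⊥ ⊤ F
  ≢⊥⇒InOpen⊥⊤ {F} F≢⊥ = L.minimum F , (λ ⊥≡F → F≢⊥ (sym ⊥≡F)) , L.maximum F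

  ⊥∉InOpen : ∀ {hi} → ¬ InOpen M ⊥ hi ⊥
  ⊥∉InOpen (_ , ⊥≢⊥ , _) = ⊥≢⊥ refl

  quadratic : Fin n → Fin n → Tm (Fin n)
  quadratic F K = (h M F - h M (K ∨ F)) * (h M K - h M (K ∨ F))

  -- The lift to A(M) of the generator h_F of the ring of the interval [lo, hi]; the
  -- generators outside (lo, hi] are zero in that ring.
  hIn : Fin n → Fin n → Fin n → Tm (Fin n)
  hIn lo hi F with inOpen? lo hi F
  ... | yes _ = h M F
  ... | no _ = 0#

  hIn-inside : ∀ {lo hi F} → InOpen M lo hi F → hIn lo hi F ≡ h M F
  hIn-inside {lo} {hi} {F} F∈ with inOpen? lo hi F
  ... | yes _ = refl
  ... | no F∉ = contradiction F∈ F∉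

  hIn-outside : ∀ {lo hi F} → ¬ InOpen M lo hi F → hIn lo hi F ≡ 0#
  hIn-outside {lo} {hi} {F} F∉ with inOpen? lo hi F
  ... | yes F∈ = contradiction F∈ F∉
  ... | no _ = refl

  bind-hIn-quadratic : ∀ {lo hi F K} → InOpen M lo hi F → InOpen M lo hi K →
    bind (hIn lo hi) (quadratic F K) ≡ quadratic F K
  bind-hIn-quadratic F∈ K∈ = cong₂ _*_ (cong₂ _-_ (hIn-inside F∈) K∨F)
                                       (cong₂ _-_ (hIn-inside K∈) K∨F)
    where K∨F = hIn-inside (InOpen-∨ F∈ K∈)

  module AlternatingSum (R : Tm (Fin n) → Set) (G : Fin n) where
    private
      module Q = CommutativeRing (quotientRing R)
    open import Algebra.Properties.Ring Q.ring using (-‿distribˡ-*; -0#≈0#)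
    open import Algebra.Properties.AbelianGroup Q.+-abelianGroup using (⁻¹-∙-comm)
    open import Relation.Binary.Reasoning.Setoid Q.setoid

    signedSum : (Fin n → Tm (Fin n)) → List (List (Fin n)) → Tm (Fin n)
    signedSum g Ss = sumTm M (map (λ S → sign M (length S) * g (foldr _∨_ G S)) Ss)

    altSum : (Fin n → Tm (Fin n)) → List (Fin n) → Tm (Fin n)
    altSum g as = signedSum g (subsets M as)

    sumTm-++ : ∀ ts us → Eq R (sumTm M (ts ++ us)) (sumTm M ts + sumTm M us)
    sumTm-++ [] us = Q.sym (Q.+-identityˡ _)
    sumTm-++ (t ∷ ts) us = Q.trans (Q.+-congˡ (sumTm-++ ts us)) (Q.sym (Q.+-assoc _ _ _))

    signedSum-map-∷ : ∀ g a Ss → Eq R (signedSum g (map (a ∷_) Ss)) (- signedSum (g ∘ (a ∨_)) Ss)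
    signedSum-map-∷ g a [] = Q.sym -0#≈0#
    signedSum-map-∷ g a (S ∷ Ss) = begin
      - sign M (length S) * g (a ∨ foldr _∨_ G S) + signedSum g (map (a ∷_) Ss)
        ≈⟨ Q.+-cong (Q.sym (-‿distribˡ-* _ _)) (signedSum-map-∷ g a Ss) ⟩
      - (sign M (length S) * g (a ∨ foldr _∨_ G S)) + - signedSum (g ∘ (a ∨_)) Ss
        ≈⟨ ⁻¹-∙-comm _ _ ⟩
      - signedSum (g ∘ (a ∨_)) (S ∷ Ss) ∎

    altSum-∷ : ∀ g a as → Eq R (altSum g (a ∷ as)) (altSum g as - altSum (g ∘ (a ∨_)) as)
    altSum-∷ g a as = begin
      altSum g (a ∷ as)
        ≡⟨ cong (sumTm M) (map-++ term (subsets M as) (map (a ∷_) (subsets M as))) ⟩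
      sumTm M (map term (subsets M as) ++ map term (map (a ∷_) (subsets M as)))
        ≈⟨ sumTm-++ (map term (subsets M as)) (map term (map (a ∷_) (subsets M as))) ⟩
      altSum g as + signedSum g (map (a ∷_) (subsets M as))
        ≈⟨ Q.+-congˡ (signedSum-map-∷ g a (subsets M as)) ⟩
      altSum g as - altSum (g ∘ (a ∨_)) as ∎
      where term = λ S → sign M (length S) * g (foldr _∨_ G S)

    signedSum-cong : ∀ {g g'} Ss → (∀ K → G ≤ K → Eq R (g K) (g' K)) →
      Eq R (signedSum g Ss) (signedSum g' Ss)
    signedSum-cong [] g≈g' = Q.refl
    signedSum-cong (S ∷ Ss) g≈g' =
      Q.+-cong (Q.*-congˡ (g≈g' _ (≤-foldr-∨ G S))) (signedSum-cong Ss g≈g')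

    signedSum-*ʳ : ∀ g c Ss → Eq R (signedSum g Ss * c) (signedSum (λ K → g K * c) Ss)
    signedSum-*ʳ g c [] = Q.zeroˡ c
    signedSum-*ʳ g c (S ∷ Ss) =
      Q.trans (Q.distribʳ c _ _) (Q.+-cong (Q.*-assoc _ _ _) (signedSum-*ʳ g c Ss))

    altSum-vanishes : ∀ {b as} g → b ∈ as → (∀ K → G ≤ K → Eq R (g K) (g (b ∨ K))) →
      Eq R (altSum g as) 0#
    altSum-vanishes {as = b ∷ as} g (here refl) invariant = begin
      altSum g (b ∷ as)                    ≈⟨ altSum-∷ g b as ⟩
      altSum g as - altSum (g ∘ (b ∨_)) as ≈⟨ Q.+-congʳ (signedSum-cong (subsets M as) invariant) ⟩
      altSum (g ∘ (b ∨_)) as - altSum (g ∘ (b ∨_)) as ≈⟨ Q.-‿inverseʳ _ ⟩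
      0#                                   ∎
    altSum-vanishes {b} {a ∷ as} g (there b∈as) invariant = begin
      altSum g (a ∷ as)                    ≈⟨ altSum-∷ g a as ⟩
      altSum g as - altSum (g ∘ (a ∨_)) as
        ≈⟨ Q.+-cong (altSum-vanishes g b∈as invariant)
                    (Q.-‿cong (altSum-vanishes (g ∘ (a ∨_)) b∈as invariant-a∨)) ⟩
      0# - 0#                              ≈⟨ Q.-‿inverseʳ 0# ⟩
      0#                                   ∎
      where
      invariant-a∨ : ∀ K → G ≤ K → Eq R (g (a ∨ K)) (g (a ∨ (b ∨ K)))
      invariant-a∨ K G≤K = Q.trans (invariant (a ∨ K) (L.trans G≤K (L.y≤x∨y a K)))
                                   (Q.reflexive (cong g (∨-lswap b a K)))

    x-*≈-altSum : ∀ c → Eq R (x M G * c) (- altSum (λ K → h M K * c) (atomsNotBelow G))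
    x-*≈-altSum c = Q.trans (Q.sym (-‿distribˡ-* _ c))
                            (Q.-‿cong (signedSum-*ʳ (h M) c (subsets M (atomsNotBelow G))))

    x-*≈0 : ∀ {F} c → ¬ F ≤ G → (∀ K → G ≤ K → Eq R (h M K * c) (h M (K ∨ F) * c)) →
      Eq R (x M G * c) 0#
    x-*≈0 {F} c F≰G absorbs with ≰⇒∃atom F≰G
    ... | b , b-atom , b≤F , b≰G = begin
      x M G * c                                        ≈⟨ x-*≈-altSum c ⟩
      - altSum (λ K → h M K * c) (atomsNotBelow G)
        ≈⟨ Q.-‿cong (altSum-vanishes _ (atom∈atomsNotBelow b-atom b≰G) invariant) ⟩
      - 0#                                             ≈⟨ -0#≈0# ⟩
      0#                                               ∎
      where
      invariant : ∀ K → G ≤ K → Eq R (h M K * c) (h M (b ∨ K) * c)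
      invariant K G≤K = begin
        h M K * c              ≈⟨ absorbs K G≤K ⟩
        h M (K ∨ F) * c        ≡⟨ cong (λ J → h M J * c) (≤⇒[x∨y]∨z≡y∨z K b≤F) ⟨
        h M ((b ∨ K) ∨ F) * c  ≈⟨ absorbs (b ∨ K) (L.trans G≤K (L.y≤x∨y b K)) ⟨
        h M (b ∨ K) * c        ∎

  module QuadraticRelations (R : Tm (Fin n) → Set) (h⊥≈0 : Eq R (h M ⊥) 0#)
    (quadratic≈0 : ∀ {F K} → InOpen M ⊥ ⊤ F → InOpen M ⊥ ⊤ K → Eq R (quadratic F K) 0#) where
    private
      module Q = CommutativeRing (quotientRing R)
    open import Algebra.Properties.Ring Q.ring using (x[y-z]≈xy-xz; x∙y⁻¹≈ε⇒x≈y)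
    open import Relation.Binary.Reasoning.Setoid Q.setoid
    open AlternatingSum R using (x-*≈0)

    quadratic≈0-all : ∀ F K → Eq R (quadratic F K) 0#
    quadratic≈0-all F K with F ≟F ⊥ | K ≟F ⊥
    ... | yes refl | _ rewrite identityʳ K = Q.trans (Q.*-congˡ (Q.-‿inverseʳ _)) (Q.zeroʳ _)
    ... | no _ | yes refl rewrite identityˡ F = Q.trans (Q.*-congʳ (Q.-‿inverseʳ _)) (Q.zeroˡ _)
    ... | no F≢⊥ | no K≢⊥ = quadratic≈0 (≢⊥⇒InOpen⊥⊤ F≢⊥) (≢⊥⇒InOpen⊥⊤ K≢⊥)

    x-*-h≈x-*-h-∨ : ∀ {G F} → ¬ F ≤ G → Eq R (x M G * h M F) (x M G * h M (F ∨ G))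
    x-*-h≈x-*-h-∨ {G} {F} F≰G =
      x∙y⁻¹≈ε⇒x≈y _ _ (Q.trans (Q.sym (x[y-z]≈xy-xz _ _ _)) (x-*≈0 G _ F≰G absorbs))
      where
      absorbs : ∀ K → G ≤ K →
        Eq R (h M K * (h M F - h M (F ∨ G))) (h M (K ∨ F) * (h M F - h M (F ∨ G)))
      absorbs K G≤K = [x-y]z≈0⇒xz≈yz _ _ _ (begin
        (h M K - h M J) * (h M F - h M (F ∨ G))
          ≈⟨ Q.*-congˡ (x-y≈[x-z]-[y-z] _ _ (h M J)) ⟩
        (h M K - h M J) * ((h M F - h M J) - (h M (F ∨ G) - h M J))
          ≈⟨ x[y-z]≈xy-xz _ _ _ ⟩
        (h M K - h M J) * (h M F - h M J) - (h M K - h M J) * (h M (F ∨ G) - h M J)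
          ≈⟨ Q.+-cong (kills F refl) (Q.-‿cong (kills (F ∨ G) (≤⇒x∨[y∨z]≡x∨y F G≤K))) ⟩
        0# - 0#
          ≈⟨ Q.-‿inverseʳ 0# ⟩
        0# ∎)
        where
        J = K ∨ F
        kills : ∀ {J} F′ → K ∨ F′ ≡ J → Eq R ((h M K - h M J) * (h M F′ - h M J)) 0#
        kills F′ refl = Q.trans (Q.*-comm _ _) (quadratic≈0-all F′ K)

    x-*-h≈0-cover : ∀ {G} → (∀ {b} → IsAtom b → ¬ b ≤ G → Eq R (x M G * h M b) 0#) →
      ∀ {a} → Covers G a → Eq R (x M G * h M a) 0#
    x-*-h≈0-cover {G} x-*-atom≈0 {a} G⋖a with ≰⇒∃atom (Covers⇒≰ G⋖a)
    ... | b , b-atom , b≤a , b≰G = begin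
      x M G * h M a       ≡⟨ cong (λ F → x M G * h M F) (Covers⇒∨≡ G⋖a b≤a b≰G) ⟨
      x M G * h M (b ∨ G) ≈⟨ x-*-h≈x-*-h-∨ b≰G ⟨
      x M G * h M b       ≈⟨ x-*-atom≈0 b-atom b≰G ⟩
      0#                  ∎

    hIn⊥≈h : ∀ {hi F} → F ≤ hi → Eq R (hIn ⊥ hi F) (h M F)
    hIn⊥≈h {F = F} F≤hi with F ≟F ⊥
    ... | yes refl = Q.trans (Q.reflexive (hIn-outside ⊥∉InOpen)) (Q.sym h⊥≈0)
    ... | no F≢⊥ = Q.reflexive (hIn-inside (L.minimum F , (λ ⊥≡F → F≢⊥ (sym ⊥≡F)) , F≤hi))

    hIn-quadratic≈0 : ∀ {lo hi F K} → InOpen M lo hi F → InOpen M lo hi K →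
      Eq R (bind (hIn lo hi) (quadratic F K)) 0#
    hIn-quadratic≈0 F∈ K∈ = Q.trans (Q.reflexive (bind-hIn-quadratic F∈ K∈))
                                    (quadratic≈0 (InOpen⇒InOpen⊥⊤ F∈) (InOpen⇒InOpen⊥⊤ K∈))

    x-*-hIn-ChowRel≈0 : ∀ {G} → (∀ {b} → IsAtom b → ¬ b ≤ G → Eq R (x M G * h M b) 0#) →
      ∀ {r} → ChowRel M G ⊤ r → Eq R (x M G * bind (hIn G ⊤) r) 0#
    x-*-hIn-ChowRel≈0 _ (outside F F∉) = ≈0⇒*≈0 _ (Q.reflexive (hIn-outside F∉))
    x-*-hIn-ChowRel≈0 _ (quad F K F∈ K∈) = ≈0⇒*≈0 _ (hIn-quadratic≈0 F∈ K∈)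
    x-*-hIn-ChowRel≈0 x-*-atom≈0 (atom a G⋖a _) =
      Q.trans (Q.*-congˡ (Q.reflexive (hIn-inside (Covers⇒InOpen G⋖a (L.maximum a)))))
              (x-*-h≈0-cover x-*-atom≈0 G⋖a)

    φ-kernel⊆annihilator : ∀ {G} {Rᴳ : Tm (Fin n) → Set} →
      (∀ {r} → Rᴳ r → Eq R (bind (hIn ⊥ G) r) 0#) →
      (∀ {b} → IsAtom b → ¬ b ≤ G → Eq R (x M G * h M b) 0#) →
      ∀ p → Eq (TensorRel Rᴳ (ChowRel M G ⊤)) (φ M G p) 0# → Eq R (x M G * p) 0#
    φ-kernel⊆annihilator {G} {Rᴳ} hIn-Rᴳ≈0 x-*-atom≈0 =
      kernel⊆annihilator (λ F → φ M G (var F)) θ (x M G) x-*-var≈x-*-θφ x-*-θ-TensorRel≈0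
      where
      θ = [ hIn ⊥ G , hIn G ⊤ ]

      x-*-var≈x-*-θφ : ∀ F → Eq R (x M G * var F) (x M G * bind θ (φ M G (var F)))
      x-*-var≈x-*-θφ F with F ≤? G
      ... | yes F≤G = Q.*-congˡ (Q.sym (hIn⊥≈h F≤G))
      ... | no F≰G = Q.trans (x-*-h≈x-*-h-∨ F≰G) (Q.*-congˡ (Q.reflexive (sym (hIn-inside F∨G∈))))
        where
        F∨G∈ : InOpen M G ⊤ (F ∨ G)
        F∨G∈ = L.y≤x∨y F G , (λ G≡F∨G → F≰G (subst (F ≤_) (sym G≡F∨G) (L.x≤x∨y F G))) , L.maximum _

      x-*-θ-TensorRel≈0 : ∀ {r} → TensorRel Rᴳ (ChowRel M G ⊤) r → Eq R (x M G * bind θ r) 0#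
      x-*-θ-TensorRel≈0 (inj₁ (q , q∈Rᴳ , refl)) =
        Q.trans (Q.reflexive (cong (x M G *_) (bind-rename θ inj₁ q))) (≈0⇒*≈0 _ (hIn-Rᴳ≈0 q∈Rᴳ))
      x-*-θ-TensorRel≈0 (inj₂ (q , q∈Rᴳ , refl)) =
        Q.trans (Q.reflexive (cong (x M G *_) (bind-rename θ inj₂ q)))
                (x-*-hIn-ChowRel≈0 x-*-atom≈0 q∈Rᴳ)

  module AugmentedChowRing =
    QuadraticRelations (augRel M) (gen (outside ⊥ ⊥∉InOpen)) (λ F∈ K∈ → gen (quad _ _ F∈ K∈))

  module ChowRing =
    QuadraticRelations (chowRel M) (gen (outside ⊥ ⊥∉InOpen)) (λ F∈ K∈ → gen (quad _ _ F∈ K∈))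

  hIn⊥-AugRel≈0 : ∀ {hi r} → AugRel M ⊥ hi r → Eq (augRel M) (bind (hIn ⊥ hi) r) 0#
  hIn⊥-AugRel≈0 (outside F F∉) rewrite hIn-outside {⊥} F∉ = refl'
  hIn⊥-AugRel≈0 (quad F K F∈ K∈) = AugmentedChowRing.hIn-quadratic≈0 F∈ K∈
  hIn⊥-AugRel≈0 (atomSq a ⊥⋖a a≤hi) rewrite hIn-inside (Covers⇒InOpen ⊥⋖a a≤hi) =
    gen (atomSq a ⊥⋖a (L.maximum a))
  hIn⊥-AugRel≈0 (atomMul a F ⊥⋖a a≤hi F∈)
    rewrite hIn-inside (Covers⇒InOpen ⊥⋖a a≤hi) | hIn-inside F∈
          | hIn-inside (InOpen-∨ (Covers⇒InOpen ⊥⋖a a≤hi) F∈) =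
    gen (atomMul a F ⊥⋖a (L.maximum a) (InOpen⇒InOpen⊥⊤ F∈))

  hIn⊥-ChowRel≈0 : ∀ {hi r} → ChowRel M ⊥ hi r → Eq (chowRel M) (bind (hIn ⊥ hi) r) 0#
  hIn⊥-ChowRel≈0 (outside F F∉) rewrite hIn-outside {⊥} F∉ = refl'
  hIn⊥-ChowRel≈0 (quad F K F∈ K∈) = ChowRing.hIn-quadratic≈0 F∈ K∈
  hIn⊥-ChowRel≈0 (atom a ⊥⋖a a≤hi) rewrite hIn-inside (Covers⇒InOpen ⊥⋖a a≤hi) =
    gen (atom a ⊥⋖a (L.maximum a))

  x-*-atom≈0-aug : ∀ {G b} → IsAtom b → ¬ b ≤ G → Eq (augRel M) (x M G * h M b) 0#
  x-*-atom≈0-aug {G} {b} b-atom b≰G = AlternatingSum.x-*≈0 (augRel M) G (h M b) b≰G absorbs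
    where
    module Q = CommutativeRing (quotientRing (augRel M))
    absorbs : ∀ K → G ≤ K → Eq (augRel M) (h M K * h M b) (h M (K ∨ b) * h M b)
    absorbs K _ with K ≟F ⊥
    ... | yes refl rewrite identityˡ b =
      Q.trans (Q.*-congʳ (gen (outside ⊥ ⊥∉InOpen)))
              (Q.trans (Q.zeroˡ _) (Q.sym (gen (atomSq b b-atom (L.maximum b)))))
    ... | no K≢⊥ = Q.trans (Q.*-comm _ _) (Q.trans (x∙y⁻¹≈ε⇒x≈y _ _
                     (gen (atomMul b K b-atom (L.maximum b) (≢⊥⇒InOpen⊥⊤ K≢⊥)))) (Q.*-comm _ _))
      where open import Algebra.Properties.Ring Q.ring using (x∙y⁻¹≈ε⇒x≈y)

  x-*-atom≈0-chow : ∀ {G b} → IsAtom b → Eq (chowRel M) (x M G * h M b) 0#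
  x-*-atom≈0-chow b-atom = ≈0⇒*≈0 _ (gen (atom _ b-atom (L.maximum _)))

lemma2p7 : (M : Matroid) →
    (∀ G → G ≢ Matroid.⊤ M → ∀ p →
      Eq (TensorRel (AugRel M (Matroid.⊥ M) G) (ChowRel M G (Matroid.⊤ M))) (φ M G p) 0# →
      Eq (augRel M) (x M G * p) 0#)
    × (∀ G → G ≢ Matroid.⊤ M → G ≢ Matroid.⊥ M → ∀ p →
      Eq (TensorRel (ChowRel M (Matroid.⊥ M) G) (ChowRel M G (Matroid.⊤ M))) (φ M G p) 0# →
      Eq (chowRel M) (x M G * p) 0#)
lemma2p7 M =
  (λ G _ → AugmentedChowRing.φ-kernel⊆annihilator M (hIn⊥-AugRel≈0 M) (x-*-atom≈0-aug M)) ,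
  (λ G _ _ → ChowRing.φ-kernel⊆annihilator M (hIn⊥-ChowRel≈0 M)
               (λ b-atom _ → x-*-atom≈0-chow M b-atom))
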